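{- Let $\alpha$ be a countably infinite order type and $S$ a sierpinskisation of $\alpha$ and $\omega$. Then the join-semilattice $I_{<\omega}(S)$ is isomorphic to a join-subsemilattice of $[\omega]^{<\omega}$ and belongs to $\mathbb{J}_\alpha$.
   Context: A sierpinskisation of a countable order type $\alpha$ and $\omega$ is a poset $(S,\le)$ whose order is the intersection of two linear orders on $S$, one of type $\alpha$ and the other of type $\omega$. $I_{<\omega}(S)$ is the set of finitely generated initial segments of $S$ ordered by inclusion; $[\omega]^{<\omega}$ is the set of finite subsets of $\omega$ ordered by inclusion. An ideal of a poset $P$ is a non-empty up-directed initial segment; $J(P)$ is the set of ideals ordered by inclusion. For a chain $C$ of type $\alpha$, $I(\alpha)$ is the order type of the chain of initial segments of $C$ under inclusion. $\mathbb{J}_\alpha$ is the class of join-semilattices $P$ with a least element such that $J(P)$ contains a chain of type $I(\alpha)$. -}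

module Defs where

open import Level using (0ℓ)
open import Data.Nat using (ℕ) renaming (_≤_ to _≤ℕ_)
open import Data.List using (List; _++_)
open import Data.List.Relation.Unary.Any using (Any)
import Data.List.Relation.Binary.Subset.Propositional as LSub
open import Data.Product using (Σ; ∃; _×_; _,_; proj₁)
open import Relation.Unary using (Pred; _∈_; _≐_; _∪_) renaming (_⊆_ to _⊆ₚ_)
open import Relation.Binary using (Rel; IsTotalOrder)
open import Relation.Binary.PropositionalEquality using (_≡_)
open import Function.Bundles using (Inverse; _↔_)

module _ {A : Set} (_⊑_ : Rel A 0ℓ) where

  IsInitialSegment : Pred A 0ℓ → Set
  IsInitialSegment X = ∀ {x y} → x ⊑ y → X y → X x

  ↓ : List A → Pred A 0ℓ
  ↓ F x = Any (x ⊑_) F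

  FinitelyGenerated : Pred A 0ℓ → Set
  FinitelyGenerated X = ∃ λ (F : List A) → X ≐ ↓ F

module _ {A : Set} (_⊑_ : Rel A 0ℓ) where

  Ifin : Set₁
  Ifin = Σ (Pred A 0ℓ) λ X → IsInitialSegment _⊑_ X × FinitelyGenerated _⊑_ X

_⊆I_ : ∀ {A : Set} {_⊑_ : Rel A 0ℓ} → Ifin _⊑_ → Ifin _⊑_ → Set
X ⊆I Y = proj₁ X ⊆ₚ proj₁ Y

InitSeg : {C : Set} → Rel C 0ℓ → Set₁
InitSeg {C} _≤_ = Σ (Pred C 0ℓ) (IsInitialSegment _≤_)

module _ {P : Set₁} (_⊑_ : Rel P 0ℓ) where

  IsIdeal : Pred P 0ℓ → Set₁
  IsIdeal I = (∃ λ x → I x)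
            × (∀ {x y} → x ⊑ y → I y → I x)
            × (∀ {x y} → I x → I y → ∃ λ z → I z × x ⊑ z × y ⊑ z)

  Ideal : Set₁
  Ideal = Σ (Pred P 0ℓ) IsIdeal

  HasLeast : Set₁
  HasLeast = ∃ λ (b : P) → ∀ x → b ⊑ x

  IsJoinOf : P → P → P → Set₁
  IsJoinOf x y z = x ⊑ z × y ⊑ z × (∀ w → x ⊑ w → y ⊑ w → z ⊑ w)

  IsJoinSemilattice : Set₁
  IsJoinSemilattice = ∀ x y → ∃ λ z → IsJoinOf x y z

  -- 𝕁_α for α the order type of the chain (C, _≤_):
  -- P is a join-semilattice with least element, and J(P) contains a
  -- chain of type I(α), i.e. there is an order embedding I(α) → J(P).
  In𝕁 : {C : Set} → Rel C 0ℓ → Set₁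
  In𝕁 _≤_ =
      IsJoinSemilattice × HasLeast
    × ∃ λ (g : InitSeg _≤_ → Ideal) →
        ∀ X Y → (proj₁ X ⊆ₚ proj₁ Y → proj₁ (g X) ⊆ₚ proj₁ (g Y))
              × (proj₁ (g X) ⊆ₚ proj₁ (g Y) → proj₁ X ⊆ₚ proj₁ Y)

-- Sierpinskisation: the order is the intersection of two linear orders

_∩ᵣ_ : {S : Set} → Rel S 0ℓ → Rel S 0ℓ → Rel S 0ℓ
(R ∩ᵣ Q) x y = R x y × Q x y

-- [ω]^{<ω}: finite subsets of ℕ, represented by lists, ordered by
-- inclusion of their sets of members; join is _++_.
_⊆ω_ : List ℕ → List ℕ → Set
_⊆ω_ = LSub._⊆_

HasTypeω : {S : Set} → Rel S 0ℓ → Set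
HasTypeω {S} _≤ω_ = Σ (S ↔ ℕ) λ e → ∀ x y → (x ≤ω y → Inverse.to e x ≤ℕ Inverse.to e y)
              × (Inverse.to e x ≤ℕ Inverse.to e y → x ≤ω y)

-- An element of I_{<ω}(S) is a finite union of principal down-sets ↓g, and ↓g only
-- contains elements whose position in the ω-enumeration is at most that of g.  Hence
-- coding a segment by the positions of its members gives a finite set, and this coding
-- preserves and reflects inclusion and turns unions into unions.  For the chain of
-- ideals, an initial segment X of α is sent to the ideal of all finitely generated
-- segments contained in X; X is recovered as the union of that ideal.
module Submission where

open import Defs
open import Level using (0ℓ)
open import Data.Nat using (ℕ; suc; s≤s; _≤_; _≤?_; _≟_)
open import Data.List using (List; []; _∷_; _++_; filter; upTo; concatMap)
open import Data.List.Relation.Unary.Any using (here)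
import Data.List.Relation.Unary.Any as Any
import Data.List.Relation.Unary.Any.Properties as Any
open import Data.List.Membership.Propositional using () renaming (_∈_ to _∈ₗ_)
open import Data.List.Membership.Propositional.Properties
  using (∈-++⁺ˡ; ∈-++⁺ʳ; ∈-++⁻; ∈-filter⁺; ∈-filter⁻; ∈-upTo⁺; ∈-concatMap⁺; ∈-concatMap⁻)
open import Data.Product using (Σ; _×_; _,_; proj₁; proj₂)
open import Data.Sum using (inj₁; inj₂; [_,_]′)
import Data.Sum as Sum
open import Data.Empty using (⊥)
open import Function.Base using (_∘_)
open import Function.Bundles using (Inverse; _↔_)
open import Function.Properties.Inverse using (↔⇒↣)
open import Relation.Nullary.Decidable using (map′; _×-dec_; via-injection)
open import Relation.Unary using (Pred; _≐_; _∪_) renaming (_⊆_ to _⊆ₚ_)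
open import Relation.Binary using (Rel; IsTotalOrder; Decidable; Reflexive; Transitive; _⇒_)
open import Relation.Binary.Consequences using (total∧dec⇒dec)
open import Relation.Binary.PropositionalEquality using (_≡_; sym; subst)

module Segments {A : Set} (_⊑_ : Rel A 0ℓ) where

  _⊆ᴵ_ : Rel (Ifin _⊑_) 0ℓ
  _⊆ᴵ_ = _⊆I_ {A} {_⊑_}

  ∅ᴵ : Ifin _⊑_
  ∅ᴵ = (λ _ → ⊥) , (λ _ ()) , [] , (λ ()) , (λ ())

  _∪ᴵ_ : Ifin _⊑_ → Ifin _⊑_ → Ifin _⊑_
  (X , X-init , F , X≐↓F) ∪ᴵ (Y , Y-init , G , Y≐↓G) =
      X ∪ Y
    , (λ x⊑y → Sum.map (X-init x⊑y) (Y-init x⊑y))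
    , F ++ G
    , (λ x∈X∪Y → [ Any.++⁺ˡ , Any.++⁺ʳ F ]′ (Sum.map (proj₁ X≐↓F) (proj₁ Y≐↓G) x∈X∪Y))
    , (λ x∈↓F++G → Sum.map (proj₂ X≐↓F) (proj₂ Y≐↓G) (Any.++⁻ F x∈↓F++G))

  ∪ᴵ-isJoin : ∀ X Y → IsJoinOf _⊆ᴵ_ X Y (X ∪ᴵ Y)
  ∪ᴵ-isJoin X Y = inj₁ , inj₂ , λ Z X⊆Z Y⊆Z → [ X⊆Z , Y⊆Z ]′

  ⊆ᴵ-isJoinSemilattice : IsJoinSemilattice _⊆ᴵ_
  ⊆ᴵ-isJoinSemilattice X Y = X ∪ᴵ Y , ∪ᴵ-isJoin X Y

  ⊆ᴵ-hasLeast : HasLeast _⊆ᴵ_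
  ⊆ᴵ-hasLeast = ∅ᴵ , λ _ ()

  segmentsWithin : Pred A 0ℓ → Ideal _⊆ᴵ_
  segmentsWithin X =
      (λ Y → proj₁ Y ⊆ₚ X)
    , (∅ᴵ , λ ())
    , (λ Y⊆Z Z⊆X y → Z⊆X (Y⊆Z y))
    , λ {Y} {Z} Y⊆X Z⊆X → Y ∪ᴵ Z , [ Y⊆X , Z⊆X ]′ , inj₁ , inj₂

  module _ (⊑-refl : Reflexive _⊑_) (⊑-trans : Transitive _⊑_) where

    principal : A → Ifin _⊑_
    principal x =
        ↓ _⊑_ (x ∷ [])
      , (λ { y⊑z (here z⊑x) → here (⊑-trans y⊑z z⊑x) })
      , x ∷ [] , (λ p → p) , (λ p → p)

    segmentsWithin-reflects : ∀ {X Y} → IsInitialSegment _⊑_ X →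
      proj₁ (segmentsWithin X) ⊆ₚ proj₁ (segmentsWithin Y) → X ⊆ₚ Y
    segmentsWithin-reflects X-init within {x} x∈X =
      within {principal x} (λ { (here y⊑x) → X-init y⊑x x∈X }) (here ⊑-refl)

    -- Initial segments of a coarser order ≤ are initial for ⊑ as well, which is what
    -- lets segmentsWithin reflect inclusion.
    ⊆ᴵ-in𝕁 : {_≤_ : Rel A 0ℓ} → _⊑_ ⇒ _≤_ → In𝕁 _⊆ᴵ_ _≤_
    ⊆ᴵ-in𝕁 ⊑⇒≤ =
        ⊆ᴵ-isJoinSemilattice , ⊆ᴵ-hasLeast
      , (λ X → segmentsWithin (proj₁ X))
      , λ X Y → (λ X⊆Y Z⊆X z → X⊆Y (Z⊆X z))
              , segmentsWithin-reflects (λ y⊑z → proj₂ X (⊑⇒≤ y⊑z))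

module Coding {A : Set} {_⊑_ : Rel A 0ℓ} (_⊑?_ : Decidable _⊑_) (e : A ↔ ℕ)
    (to-mono : ∀ {x y} → x ⊑ y → Inverse.to e x ≤ Inverse.to e y) where

  open Inverse e using (to; from; strictlyInverseˡ; strictlyInverseʳ)
  open Segments _⊑_ using (_⊆ᴵ_)

  codesBelow : A → List ℕ
  codesBelow g = filter (λ n → from n ⊑? g) (upTo (suc (to g)))

  ∈-codesBelow⁻ : ∀ {n g} → n ∈ₗ codesBelow g → from n ⊑ g
  ∈-codesBelow⁻ {g = g} n∈ = proj₂ (∈-filter⁻ (λ n → from n ⊑? g) n∈)

  ∈-codesBelow⁺ : ∀ {n g} → from n ⊑ g → n ∈ₗ codesBelow g
  ∈-codesBelow⁺ {n} {g} n⊑g = ∈-filter⁺ (λ n → from n ⊑? g) (∈-upTo⁺ (s≤s n≤g)) n⊑g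
    where
    n≤g : n ≤ to g
    n≤g = subst (_≤ to g) (strictlyInverseˡ n) (to-mono n⊑g)

  code : Ifin _⊑_ → List ℕ
  code (_ , _ , F , _) = concatMap codesBelow F

  ∈-code⁻ : ∀ X {n} → n ∈ₗ code X → proj₁ X (from n)
  ∈-code⁻ (_ , _ , F , X≐↓F) n∈ =
    proj₂ X≐↓F (Any.map ∈-codesBelow⁻ (∈-concatMap⁻ codesBelow n∈))

  ∈-code⁺ : ∀ X {n} → proj₁ X (from n) → n ∈ₗ code X
  ∈-code⁺ (_ , _ , F , X≐↓F) n∈X =
    ∈-concatMap⁺ codesBelow (Any.map ∈-codesBelow⁺ (proj₁ X≐↓F n∈X))

  code-mono : ∀ X Y → X ⊆ᴵ Y → code X ⊆ω code Y
  code-mono X Y X⊆Y n∈ = ∈-code⁺ Y (X⊆Y (∈-code⁻ X n∈))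

  code-reflects : ∀ X Y → code X ⊆ω code Y → X ⊆ᴵ Y
  code-reflects X Y codeX⊆codeY {x} x∈X =
    subst (proj₁ Y) (strictlyInverseʳ x)
      (∈-code⁻ Y (codeX⊆codeY (∈-code⁺ X (subst (proj₁ X) (sym (strictlyInverseʳ x)) x∈X))))

  code-∪ : ∀ X Y Z → proj₁ Z ≐ (proj₁ X ∪ proj₁ Y)
    → (code Z ⊆ω (code X ++ code Y)) × ((code X ++ code Y) ⊆ω code Z)
  code-∪ X Y Z (Z⊆X∪Y , X∪Y⊆Z) =
      (λ n∈ → [ ∈-++⁺ˡ ∘ ∈-code⁺ X , ∈-++⁺ʳ (code X) ∘ ∈-code⁺ Y ]′ (Z⊆X∪Y (∈-code⁻ Z n∈)))
    , λ n∈ → ∈-code⁺ Z (X∪Y⊆Z (Sum.map (∈-code⁻ X) (∈-code⁻ Y) (∈-++⁻ (code X) n∈)))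

lemma2p1 : (S : Set) (_≤α_ _≤ω_ : Rel S 0ℓ)
    → IsTotalOrder _≡_ _≤α_
    → IsTotalOrder _≡_ _≤ω_
    → HasTypeω _≤ω_
    → (Σ (Ifin (_≤α_ ∩ᵣ _≤ω_) → List ℕ) λ f →
          (∀ A B → (A ⊆I B → f A ⊆ω f B) × (f A ⊆ω f B → A ⊆I B))
        × (∀ A B C → proj₁ C ≐ (proj₁ A ∪ proj₁ B)
             → (f C ⊆ω (f A ++ f B)) × ((f A ++ f B) ⊆ω f C)))
      × In𝕁 (_⊆I_ {S} {_≤α_ ∩ᵣ _≤ω_}) _≤α_
lemma2p1 S _≤α_ _≤ω_ α-total ω-total (e , ≤ω⇔≤) =
    (code , (λ X Y → code-mono X Y , code-reflects X Y) , code-∪)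
  , Segments.⊆ᴵ-in𝕁 _⊑_ ⊑-refl ⊑-trans proj₁
  where
  module α = IsTotalOrder α-total
  module ω = IsTotalOrder ω-total

  _⊑_ : Rel S 0ℓ
  _⊑_ = _≤α_ ∩ᵣ _≤ω_

  ⊑-refl : Reflexive _⊑_
  ⊑-refl = α.refl , ω.refl

  ⊑-trans : Transitive _⊑_
  ⊑-trans (x≤αy , x≤ωy) (y≤αz , y≤ωz) = α.trans x≤αy y≤αz , ω.trans x≤ωy y≤ωz

  _≟S_ : Decidable (_≡_ {A = S})
  _≟S_ = via-injection (↔⇒↣ e) _≟_

  _⊑?_ : Decidable _⊑_
  x ⊑? y = total∧dec⇒dec α.reflexive α.antisym α.total _≟S_ x y
        ×-dec map′ (proj₂ (≤ω⇔≤ x y)) (proj₁ (≤ω⇔≤ x y)) (Inverse.to e x ≤? Inverse.to e y)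

  open Coding _⊑?_ e (λ {x} {y} x⊑y → proj₁ (≤ω⇔≤ x y) (proj₂ x⊑y))
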